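{- Let $\Gamma$, $\pi$, $\breve\Gamma$ with its linear order and the operation $\circ$ be as in the context, and fix $\gamma\in\Gamma$. Then for every $\beta\in\breve\Gamma$ the set $\{\varphi\in\breve\Gamma:\ \varphi\circ\beta\circ\gamma>0\}$ (where $0$ is the neutral element of $\Gamma\subset\breve\Gamma$) has a minimum element; this minimum is denoted $\beta^{\perp(\gamma)}\in\breve\Gamma$.
   Context: $\Gamma$ is an abelian group with a fixed exact sequence $0\to\mathbb Z\to\Gamma\xrightarrow{\pi}\mathbb Z\to0$ (no splitting fixed); each fibre $\pi^{ -1}(n)$ is a $\mathbb Z$-torsor via $\ker\pi=\mathbb Z$. $\Gamma$ is linearly ordered by: $\gamma_1>\gamma_2$ iff $\pi(\gamma_1)>\pi(\gamma_2)$, or $\pi(\gamma_1)=\pi(\gamma_2)$ and $\gamma_1-\gamma_2\in\ker\pi=\mathbb Z$ is positive. $\breve\Gamma=\Gamma\sqcup\pi(\Gamma)$; elements of $\pi(\Gamma)=\mathbb Z$ are written $(n,-\infty)$, elements of $\Gamma$ as $(n,p)$ with $p\in\pi^{ -1}(n)$; $\breve\pi:\breve\Gamma\to\mathbb Z$ extends $\pi$ by $\breve\pi(n,-\infty)=n$. The linear order on $\breve\Gamma$: $\alpha_1<\alpha_2$ if $\breve\pi(\alpha_1)<\breve\pi(\alpha_2)$; $(n,-\infty)<(n,p)$ for $p\in\pi^{ -1}(n)$; within $\Gamma$ the order above. The commutative operation $\circ$ on $\breve\Gamma$ is: group addition on $\Gamma\times\Gamma$, $(n,p)\circ(m,-\infty)=(m,-\infty)\circ(n,p)=(n+m,-\infty)$,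 and $(n,-\infty)\circ(m,-\infty)=(n+m,-\infty)$. -}

module Defs where

open import Level using (Level; _⊔_; suc)
open import Algebra.Bundles using (AbelianGroup)
open import Data.Integer as ℤ using (ℤ; +_; +0)
open import Data.Product using (Σ; ∃; _×_; _,_)
open import Data.Sum using (_⊎_)
open import Relation.Binary.PropositionalEquality using (_≡_)

-- An abelian group Γ together with a fixed short exact sequence
--   0 → ℤ --ι--> Γ --π--> ℤ → 0
-- (no splitting fixed).  Equality in Γ is the setoid equality _≈_ of the bundle.
record ExtZZ (c ℓ : Level) : Set (suc (c ⊔ ℓ)) where
  field
    Γ : AbelianGroup c ℓ
  open AbelianGroup Γ public
  field
    ι      : ℤ → Carrier
    π      : Carrier → ℤ
    ι-cong : ∀ {a b} → a ≡ b → ι a ≈ ι b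
    ι-hom  : ∀ a b → ι (a ℤ.+ b) ≈ (ι a ∙ ι b)
    π-cong : ∀ {x y} → x ≈ y → π x ≡ π y
    π-hom  : ∀ x y → π (x ∙ y) ≡ π x ℤ.+ π y
    ι-inj  : ∀ a b → ι a ≈ ι b → a ≡ b
    πι≡0   : ∀ a → π (ι a) ≡ +0
    ker⊆im : ∀ x → π x ≡ +0 → ∃ λ a → ι a ≈ x
    π-surj : ∀ n → ∃ λ x → π x ≡ n

  _<Γ_ : Carrier → Carrier → Set (c ⊔ ℓ)
  x <Γ y = Lift' (π x ℤ.< π y) ⊎ (Lift' (π x ≡ π y) × ∃ λ k → Lift' (+0 ℤ.< k) × (ι k ≈ (y ∙ (x ⁻¹))))
    where
    Lift' : Set → Set (c ⊔ ℓ)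
    Lift' A = Level.Lift (c ⊔ ℓ) A

  -- Γ̆ = Γ ⊔ ℤ ; element (n , p) with p ∈ π⁻¹(n) is  fin p  (n = π p is determined),
  -- element (n , -∞) is  -∞ n.
  data Γ̆ : Set c where
    fin : Carrier → Γ̆
    -∞  : ℤ → Γ̆

  π̆ : Γ̆ → ℤ
  π̆ (fin p) = π p
  π̆ (-∞ n)  = n

  data _≈̆_ : Γ̆ → Γ̆ → Set (c ⊔ ℓ) where
    fin≈ : ∀ {p q} → p ≈ q → fin p ≈̆ fin q
    -∞≈  : ∀ {n m} → n ≡ m → -∞ n ≈̆ -∞ m

  data _<̆_ : Γ̆ → Γ̆ → Set (c ⊔ ℓ) where
    π̆<    : ∀ {α β} → π̆ α ℤ.< π̆ β → α <̆ β
    -∞<fin : ∀ {n p} → π p ≡ n → -∞ n <̆ fin p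
    fin<  : ∀ {p q} → π p ≡ π q → p <Γ q → fin p <̆ fin q

  _≤̆_ : Γ̆ → Γ̆ → Set (c ⊔ ℓ)
  α ≤̆ β = α <̆ β ⊎ α ≈̆ β

  _∘̆_ : Γ̆ → Γ̆ → Γ̆
  fin p ∘̆ fin q = fin (p ∙ q)
  fin p ∘̆ -∞ m  = -∞ (π p ℤ.+ m)
  -∞ n  ∘̆ fin q = -∞ (n ℤ.+ π q)
  -∞ n  ∘̆ -∞ m  = -∞ (n ℤ.+ m)

  HasMinimum : (Γ̆ → Set (c ⊔ ℓ)) → Set (c ⊔ ℓ)
  HasMinimum S = Σ Γ̆ λ μ → S μ × (∀ φ → S φ → μ ≤̆ φ)

{-# OPTIONS --safe #-}
module Submission where

-- Translation by an element of Γ is an order automorphism of Γ̆, and the least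
-- element of Γ̆ above 0 is ι 1; so for β ∈ Γ the minimum is ι 1 ∘ (β ∘ γ)⁻¹.
-- For β = (m, -∞) the product φ ∘ β ∘ γ is (π̆ φ + m + π γ, -∞), which is
-- positive exactly when π̆ φ ≥ 1 - m - π γ, and the least element of Γ̆ above a
-- given level of π̆ is the -∞ element of that level.

open import Defs
open import Level using (_⊔_; lift)
import Algebra.Properties.AbelianGroup as AbelianGroupProperties
import Algebra.Properties.CommutativeSemigroup as CommutativeSemigroupProperties
open import Data.Integer as ℤ using (ℤ; 0ℤ; 1ℤ; +[1+_])
import Data.Integer.Properties as ℤₚ
open import Data.Integer.Tactic.RingSolver using (solve-∀)
open import Data.Nat as ℕ using (zero; suc)
open import Data.Product using (_,_)
open import Data.Sum using (inj₁; inj₂)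
open import Relation.Binary.Bundles using (Setoid)
open import Relation.Nullary using (yes; no)
open import Relation.Binary.PropositionalEquality as ≡ using (_≡_; subst)
import Relation.Binary.Reasoning.Setoid as SetoidReasoning

0<i+j⇒1-j≤i : ∀ i j → 0ℤ ℤ.< i ℤ.+ j → 1ℤ ℤ.- j ℤ.≤ i
0<i+j⇒1-j≤i i j 0<i+j = subst (1ℤ ℤ.- j ℤ.≤_) (cancel i j)
  (ℤₚ.+-monoˡ-≤ (ℤ.- j) (ℤₚ.i<j⇒suc[i]≤j 0<i+j))
  where
  cancel : ∀ i j → (i ℤ.+ j) ℤ.- j ≡ i
  cancel = solve-∀

1-j≤i⇒0<i+j : ∀ i j → 1ℤ ℤ.- j ℤ.≤ i → 0ℤ ℤ.< i ℤ.+ j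
1-j≤i⇒0<i+j i j 1-j≤i = ℤₚ.suc[i]≤j⇒i<j
  (subst (ℤ._≤ i ℤ.+ j) (cancel j) (ℤₚ.+-monoˡ-≤ j 1-j≤i))
  where
  cancel : ∀ j → (1ℤ ℤ.- j) ℤ.+ j ≡ 1ℤ
  cancel = solve-∀

module _ {a ℓ} (E : ExtZZ a ℓ) where
  open ExtZZ E
  open AbelianGroupProperties Γ using (⁻¹-∙-comm; xyx⁻¹≈y; ε⁻¹≈ε)
  open CommutativeSemigroupProperties commutativeSemigroup using (interchange)
  open AbelianGroupProperties ℤₚ.+-0-abelianGroup using ()
    renaming (identityˡ-unique to ℤ-identityˡ-unique)

  π-ε : π ε ≡ 0ℤ
  π-ε = ℤ-identityˡ-unique (π ε) (π ε) (≡.trans (≡.sym (π-hom ε ε)) (π-cong (identityˡ ε)))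

  π-∙-congˡ : ∀ z {x y} → π x ≡ π y → π (x ∙ z) ≡ π (y ∙ z)
  π-∙-congˡ z {x} {y} πx≡πy = ≡.trans (π-hom x z) (≡.trans (≡.cong (ℤ._+ π z) πx≡πy) (≡.sym (π-hom y z)))

  ∙-cancelʳ-difference : ∀ x y z → (y ∙ z) ∙ (x ∙ z) ⁻¹ ≈ y ∙ x ⁻¹
  ∙-cancelʳ-difference x y z = begin
    (y ∙ z) ∙ (x ∙ z) ⁻¹    ≈⟨ ∙-congˡ (⁻¹-∙-comm x z) ⟨
    (y ∙ z) ∙ (x ⁻¹ ∙ z ⁻¹) ≈⟨ interchange y z (x ⁻¹) (z ⁻¹) ⟩
    (y ∙ x ⁻¹) ∙ (z ∙ z ⁻¹) ≈⟨ ∙-congˡ (inverseʳ z) ⟩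
    (y ∙ x ⁻¹) ∙ ε          ≈⟨ identityʳ _ ⟩
    y ∙ x ⁻¹                ∎
    where open SetoidReasoning setoid

  <Γ-respʳ-≈ : ∀ {x y y′} → x <Γ y → y ≈ y′ → x <Γ y′
  <Γ-respʳ-≈ (inj₁ (lift πx<πy)) y≈y′ = inj₁ (lift (subst (π _ ℤ.<_) (π-cong y≈y′) πx<πy))
  <Γ-respʳ-≈ (inj₂ (lift πx≡πy , k , k>0 , ιk≈y-x)) y≈y′ =
    inj₂ (lift (≡.trans πx≡πy (π-cong y≈y′)) , k , k>0 , trans ιk≈y-x (∙-congʳ y≈y′))

  ∙-monoˡ-<Γ : ∀ z {x y} → x <Γ y → (x ∙ z) <Γ (y ∙ z)
  ∙-monoˡ-<Γ z {x} {y} (inj₁ (lift πx<πy)) = inj₁ (lift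
    (≡.subst₂ ℤ._<_ (≡.sym (π-hom x z)) (≡.sym (π-hom y z)) (ℤₚ.+-monoˡ-< (π z) πx<πy)))
  ∙-monoˡ-<Γ z {x} {y} (inj₂ (lift πx≡πy , k , k>0 , ιk≈y-x)) =
    inj₂ (lift (π-∙-congˡ z πx≡πy) , k , k>0 , trans ιk≈y-x (sym (∙-cancelʳ-difference x y z)))

  ≈̆-refl : ∀ {α} → α ≈̆ α
  ≈̆-refl {fin p} = fin≈ refl
  ≈̆-refl { -∞ n} = -∞≈ ≡.refl

  ≈̆-sym : ∀ {α β} → α ≈̆ β → β ≈̆ α
  ≈̆-sym (fin≈ p≈q) = fin≈ (sym p≈q)
  ≈̆-sym (-∞≈ n≡m)  = -∞≈ (≡.sym n≡m)

  ≈̆-trans : ∀ {α β δ} → α ≈̆ β → β ≈̆ δ → α ≈̆ δ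
  ≈̆-trans (fin≈ p≈q) (fin≈ q≈r) = fin≈ (trans p≈q q≈r)
  ≈̆-trans (-∞≈ n≡m)  (-∞≈ m≡k)  = -∞≈ (≡.trans n≡m m≡k)

  Γ̆-setoid : Setoid a (a ⊔ ℓ)
  Γ̆-setoid = record
    { Carrier       = Γ̆
    ; _≈_           = _≈̆_
    ; isEquivalence = record { refl = ≈̆-refl ; sym = ≈̆-sym ; trans = ≈̆-trans } }

  π̆-cong : ∀ {α β} → α ≈̆ β → π̆ α ≡ π̆ β
  π̆-cong (fin≈ p≈q) = π-cong p≈q
  π̆-cong (-∞≈ n≡m)  = n≡m

  <̆-respʳ-≈̆ : ∀ {α β β′} → α <̆ β → β ≈̆ β′ → α <̆ β′
  <̆-respʳ-≈̆ {α} (π̆< π̆α<π̆β)      β≈β′       = π̆< (subst (π̆ α ℤ.<_) (π̆-cong β≈β′) π̆α<π̆β)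
  <̆-respʳ-≈̆ (-∞<fin πp≡n)         (fin≈ p≈q) = -∞<fin (≡.trans (≡.sym (π-cong p≈q)) πp≡n)
  <̆-respʳ-≈̆ (fin< πp≡πq p<Γq)     (fin≈ q≈r) = fin< (≡.trans πp≡πq (π-cong q≈r)) (<Γ-respʳ-≈ p<Γq q≈r)

  ≤̆-respʳ-≈̆ : ∀ {α β β′} → α ≤̆ β → β ≈̆ β′ → α ≤̆ β′
  ≤̆-respʳ-≈̆ (inj₁ α<β) β≈β′ = inj₁ (<̆-respʳ-≈̆ α<β β≈β′)
  ≤̆-respʳ-≈̆ (inj₂ α≈β) β≈β′ = inj₂ (≈̆-trans α≈β β≈β′)

  π̆-∘̆-fin : ∀ α z → π̆ (α ∘̆ fin z) ≡ π̆ α ℤ.+ π z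
  π̆-∘̆-fin (fin p) z = π-hom p z
  π̆-∘̆-fin (-∞ n)  z = ≡.refl

  ∘̆-fin-congˡ : ∀ z {α β} → α ≈̆ β → (α ∘̆ fin z) ≈̆ (β ∘̆ fin z)
  ∘̆-fin-congˡ z (fin≈ p≈q) = fin≈ (∙-congʳ p≈q)
  ∘̆-fin-congˡ z (-∞≈ n≡m)  = -∞≈ (≡.cong (ℤ._+ π z) n≡m)

  ∘̆-fin-congʳ : ∀ α {x y} → x ≈ y → (α ∘̆ fin x) ≈̆ (α ∘̆ fin y)
  ∘̆-fin-congʳ (fin p) x≈y = fin≈ (∙-congˡ x≈y)
  ∘̆-fin-congʳ (-∞ n)  x≈y = -∞≈ (≡.cong (ℤ._+_ n) (π-cong x≈y))

  ∘̆-fin-assoc : ∀ α x y → ((α ∘̆ fin x) ∘̆ fin y) ≈̆ (α ∘̆ fin (x ∙ y))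
  ∘̆-fin-assoc (fin p) x y = fin≈ (assoc p x y)
  ∘̆-fin-assoc (-∞ n)  x y =
    -∞≈ (≡.trans (ℤₚ.+-assoc n (π x) (π y)) (≡.cong (ℤ._+_ n) (≡.sym (π-hom x y))))

  ∘̆-fin-identityʳ : ∀ α → (α ∘̆ fin ε) ≈̆ α
  ∘̆-fin-identityʳ (fin p) = fin≈ (identityʳ p)
  ∘̆-fin-identityʳ (-∞ n)  = -∞≈ (≡.trans (≡.cong (ℤ._+_ n) π-ε) (ℤₚ.+-identityʳ n))

  ∘̆-fin-cancel : ∀ α {x y} → x ∙ y ≈ ε → ((α ∘̆ fin x) ∘̆ fin y) ≈̆ α
  ∘̆-fin-cancel α {x} {y} x∙y≈ε = begin
    (α ∘̆ fin x) ∘̆ fin y ≈⟨ ∘̆-fin-assoc α x y ⟩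
    α ∘̆ fin (x ∙ y)     ≈⟨ ∘̆-fin-congʳ α x∙y≈ε ⟩
    α ∘̆ fin ε           ≈⟨ ∘̆-fin-identityʳ α ⟩
    α                   ∎
    where open SetoidReasoning Γ̆-setoid

  ∘̆-fin-mono-<̆ : ∀ z {α β} → α <̆ β → (α ∘̆ fin z) <̆ (β ∘̆ fin z)
  ∘̆-fin-mono-<̆ z {α} {β} (π̆< π̆α<π̆β) = π̆< (≡.subst₂ ℤ._<_ (≡.sym (π̆-∘̆-fin α z)) (≡.sym (π̆-∘̆-fin β z))
    (ℤₚ.+-monoˡ-< (π z) π̆α<π̆β))
  ∘̆-fin-mono-<̆ z {β = fin p} (-∞<fin πp≡n) = -∞<fin (≡.trans (π-hom p z) (≡.cong (ℤ._+ π z) πp≡n))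
  ∘̆-fin-mono-<̆ z {fin p} {fin q} (fin< πp≡πq p<Γq) = fin< (π-∙-congˡ z πp≡πq) (∙-monoˡ-<Γ z p<Γq)

  ∘̆-fin-mono-≤̆ : ∀ z {α β} → α ≤̆ β → (α ∘̆ fin z) ≤̆ (β ∘̆ fin z)
  ∘̆-fin-mono-≤̆ z (inj₁ α<β) = inj₁ (∘̆-fin-mono-<̆ z α<β)
  ∘̆-fin-mono-≤̆ z (inj₂ α≈β) = inj₂ (∘̆-fin-congˡ z α≈β)

  π-ι1≡π-ε : π (ι 1ℤ) ≡ π ε
  π-ι1≡π-ε = ≡.trans (πι≡0 1ℤ) (≡.sym π-ε)

  ε<̆ι1 : fin ε <̆ fin (ι 1ℤ)
  ε<̆ι1 = fin< πε≡πι1 (inj₂ (lift πε≡πι1 , 1ℤ , lift (ℤ.+<+ ℕ.z<s) , ι1≈ι1-ε))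
    where
    πε≡πι1 : π ε ≡ π (ι 1ℤ)
    πε≡πι1 = ≡.sym π-ι1≡π-ε
    ι1≈ι1-ε : ι 1ℤ ≈ ι 1ℤ ∙ ε ⁻¹
    ι1≈ι1-ε = sym (trans (∙-congˡ ε⁻¹≈ε) (identityʳ _))

  ι-difference : ∀ i j → ι j ≈ ι (i ℤ.+ j) ∙ ι i ⁻¹
  ι-difference i j = begin
    ι j                    ≈⟨ xyx⁻¹≈y (ι i) (ι j) ⟨
    (ι i ∙ ι j) ∙ ι i ⁻¹   ≈⟨ ∙-congʳ (ι-hom i j) ⟨
    ι (i ℤ.+ j) ∙ ι i ⁻¹   ∎
    where open SetoidReasoning setoid

  ι1≤̆ι : ∀ k → 0ℤ ℤ.< k → fin (ι 1ℤ) ≤̆ fin (ι k)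
  ι1≤̆ι (ℤ.+ zero)   (ℤ.+<+ ())
  ι1≤̆ι +[1+ zero ]  _ = inj₂ ≈̆-refl
  ι1≤̆ι +[1+ suc j ] _ = inj₁ (fin< πι1≡πιk
    (inj₂ (lift πι1≡πιk , ℤ.+ suc j , lift (ℤ.+<+ ℕ.z<s) , ι-difference 1ℤ (ℤ.+ suc j))))
    where
    πι1≡πιk : π (ι 1ℤ) ≡ π (ι +[1+ suc j ])
    πι1≡πιk = ≡.trans (πι≡0 1ℤ) (≡.sym (πι≡0 _))

  ι1-least-positive : ∀ {ψ} → fin ε <̆ ψ → fin (ι 1ℤ) ≤̆ ψ
  ι1-least-positive {ψ} (π̆< πε<π̆ψ) = inj₁ (π̆< (subst (ℤ._< π̆ ψ) (≡.sym π-ι1≡π-ε) πε<π̆ψ))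
  ι1-least-positive {fin x} (fin< _ (inj₁ (lift πε<πx))) = inj₁ (π̆< (subst (ℤ._< π x) (≡.sym π-ι1≡π-ε) πε<πx))
  ι1-least-positive (fin< _ (inj₂ (_ , k , lift k>0 , ιk≈x-ε))) =
    ≤̆-respʳ-≈̆ (ι1≤̆ι k k>0) (fin≈ (trans ιk≈x-ε (trans (∙-congˡ ε⁻¹≈ε) (identityʳ _))))

  -∞-least : ∀ {n} φ → n ℤ.≤ π̆ φ → -∞ n ≤̆ φ
  -∞-least {n} φ n≤π̆φ with n ℤ.≟ π̆ φ
  -∞-least (fin p) _ | yes n≡πp = inj₁ (-∞<fin (≡.sym n≡πp))
  -∞-least (-∞ k)  _ | yes n≡k  = inj₂ (-∞≈ n≡k)
  -∞-least φ n≤π̆φ    | no n≢π̆φ  = inj₁ (π̆< (ℤₚ.≤∧≢⇒< n≤π̆φ n≢π̆φ))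

  ε<̆-∞⇒0< : ∀ {n} → fin ε <̆ -∞ n → 0ℤ ℤ.< n
  ε<̆-∞⇒0< (π̆< πε<n) = subst (ℤ._< _) π-ε πε<n

  0<⇒ε<̆-∞ : ∀ {n} → 0ℤ ℤ.< n → fin ε <̆ -∞ n
  0<⇒ε<̆-∞ 0<n = π̆< (subst (ℤ._< _) (≡.sym π-ε) 0<n)

  ∘̆-∞-∘̆-fin : ∀ φ m γ → (φ ∘̆ -∞ m) ∘̆ fin γ ≡ -∞ (π̆ φ ℤ.+ (m ℤ.+ π γ))
  ∘̆-∞-∘̆-fin (fin p) m γ = ≡.cong -∞ (ℤₚ.+-assoc (π p) m (π γ))
  ∘̆-∞-∘̆-fin (-∞ k)  m γ = ≡.cong -∞ (ℤₚ.+-assoc k m (π γ))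

  hasMinimum-∘̆-fin : ∀ b γ → HasMinimum (λ φ → fin ε <̆ ((φ ∘̆ fin b) ∘̆ fin γ))
  hasMinimum-∘̆-fin b γ = μ , <̆-respʳ-≈̆ ε<̆ι1 ι1≈μbγ , least
    where
    open SetoidReasoning Γ̆-setoid
    c : Carrier
    c = b ∙ γ
    μ : Γ̆
    μ = fin (ι 1ℤ) ∘̆ fin (c ⁻¹)
    ι1≈μbγ : fin (ι 1ℤ) ≈̆ ((μ ∘̆ fin b) ∘̆ fin γ)
    ι1≈μbγ = begin
      fin (ι 1ℤ)           ≈⟨ ∘̆-fin-cancel (fin (ι 1ℤ)) (inverseˡ c) ⟨
      μ ∘̆ fin c            ≈⟨ ∘̆-fin-assoc μ b γ ⟨
      (μ ∘̆ fin b) ∘̆ fin γ  ∎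
    least : ∀ φ → fin ε <̆ ((φ ∘̆ fin b) ∘̆ fin γ) → μ ≤̆ φ
    least φ ε<φbγ = ≤̆-respʳ-≈̆ (∘̆-fin-mono-≤̆ (c ⁻¹) (ι1-least-positive ε<φbγ)) (begin
      ((φ ∘̆ fin b) ∘̆ fin γ) ∘̆ fin (c ⁻¹) ≈⟨ ∘̆-fin-congˡ (c ⁻¹) (∘̆-fin-assoc φ b γ) ⟩
      (φ ∘̆ fin c) ∘̆ fin (c ⁻¹)            ≈⟨ ∘̆-fin-cancel φ (inverseʳ c) ⟩
      φ                                   ∎)

  hasMinimum-∘̆-∞ : ∀ m γ → HasMinimum (λ φ → fin ε <̆ ((φ ∘̆ -∞ m) ∘̆ fin γ))
  hasMinimum-∘̆-∞ m γ = -∞ n , member , least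
    where
    s n : ℤ
    s = m ℤ.+ π γ
    n = 1ℤ ℤ.- s
    member : fin ε <̆ ((-∞ n ∘̆ -∞ m) ∘̆ fin γ)
    member = subst (fin ε <̆_) (≡.sym (∘̆-∞-∘̆-fin (-∞ n) m γ))
      (0<⇒ε<̆-∞ (1-j≤i⇒0<i+j n s ℤₚ.≤-refl))
    least : ∀ φ → fin ε <̆ ((φ ∘̆ -∞ m) ∘̆ fin γ) → -∞ n ≤̆ φ
    least φ ε<φmγ = -∞-least φ
      (0<i+j⇒1-j≤i (π̆ φ) s (ε<̆-∞⇒0< (subst (fin ε <̆_) (∘̆-∞-∘̆-fin φ m γ) ε<φmγ)))

proposition8 : ∀ {c ℓ} (E : ExtZZ c ℓ) → let open ExtZZ E in
                 (γ : Carrier) (β : Γ̆) →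
                 HasMinimum (λ φ → fin ε <̆ ((φ ∘̆ β) ∘̆ fin γ))
proposition8 E γ (ExtZZ.fin b) = hasMinimum-∘̆-fin E b γ
proposition8 E γ (ExtZZ.-∞ m)  = hasMinimum-∘̆-∞ E m γ
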